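{- Let $r,s\in\mathbb N$ with $r\ge 2s$, and let $a_1,\dots,a_{2s-1}\in[1,r-1]$ with $a_i<a_{i+1}$ for $i=1,\dots,2s-2$ (if $s\ge 2$). Let, for $s\ge 2$, $x_i=\sum_{j=1}^{i}a_{2j}-\sum_{j=0}^{i-1}a_{2j+1}$ for $i=1,\dots,s-1$; let $y_1=r-a_1$ and, for $s\ge2$, $y_i=r+\sum_{j=1}^{i-1}a_{2j}-\sum_{j=0}^{i-1}a_{2j+1}$ for $i=2,\dots,s$. Let $G$ be a bipartite graph with vertex bipartition $\{A,B\}$ with $|A|=|B|=s$, and let $f\colon A\cup B\to[0,r-1]$ be a $\overline{\rho}$-labeling with $f(A)=\{0,x_1,\dots,x_{s-1}\}$ and $f(B)=\{y_1,\dots,y_s\}$. Then: (1) the $k$-shift $f_k$ is an $(A,B,r-1)$-uniformly ordered labeling of $G$ if and only if $k\in[0,a_1-1]$; (2) $f_k$ is $(B,A,r-1)$-uniformly ordered if and only if $k\in[r-y_s,\,r-1-x_{s-1}]$.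
   Context: $\mathbb N=\{0,1,2,\dots\}$; $[a,b]=\{x\in\mathbb N: a\le x\le b\}$. Graphs have no isolated vertices. For a graph $G=(V,E)$ with $|E|=m$ and $t\in\mathbb N$, a labeling is an injective map $f\colon V\to[0,t]$; it induces $\tilde f(\{u,v\})=|f(u)-f(v)|$. $f$ is a $\overline{\rho}$-labeling if (a) $t\ge 2m$, (b) $\tilde f$ is injective, (c) there is no $i\in\{1,\dots,m\}$ with both $i$ and $t+1-i$ in $\operatorname{Im}\tilde f$. For bipartite $G$ with vertex bipartition $\{A,B\}$, an $(A,B,t)$-uniformly ordered labeling is a $\overline{\rho}$-labeling $f\colon V\to[0,t]$ such that there is $\lambda\in\mathbb N$ with $f(a)\le\lambda$ for all $a\in A$ and $f(b)>\lambda$ for all $b\in B$; $(B,A,t)$-uniformly ordered is defined with $A,B$ exchanged. For $k\in[0,t]$, the $k$-shift of $f$ is $f_k(v)=f(v)+k$ reduced modulo $t+1$ into $[0,t]$. -}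

module Defs where

open import Data.Nat using (ℕ; zero; suc; _+_; _*_; _∸_; _≤_; _<_; _%_; ∣_-_∣)
open import Data.Integer as ℤ using (ℤ; +_)
open import Data.Fin using (Fin)
open import Data.Sum using (_⊎_; inj₁; inj₂)
open import Data.Product using (_×_; _,_; Σ; ∃; ∃-syntax)
open import Data.List using (List; length)
open import Data.List.Membership.Propositional using (_∈_)
open import Data.List.Relation.Unary.Unique.Propositional using (Unique)
open import Relation.Nullary using (¬_)
open import Relation.Binary.PropositionalEquality using (_≡_)

-- Vertices of a bipartite graph with parts A and B, |A| = |B| = s:
-- A = inj₁ of Fin s, B = inj₂ of Fin s.
V : ℕ → Set
V s = Fin s ⊎ Fin s

Edge : ℕ → Set
Edge s = Fin s × Fin s

endA : ∀ {s} → Edge s → V s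
endA (a , _) = inj₁ a

endB : ∀ {s} → Edge s → V s
endB (_ , b) = inj₂ b

record BipGraph (s : ℕ) : Set where
  field
    edges     : List (Edge s)
    unique    : Unique edges
    noIsolated : (v : V s) → ∃[ e ] (e ∈ edges × (endA e ≡ v ⊎ endB e ≡ v))

open BipGraph public

nEdges : ∀ {s} → BipGraph s → ℕ
nEdges G = length (edges G)

edgeLabel : ∀ {s} → (V s → ℕ) → Edge s → ℕ
edgeLabel f e = ∣ f (endA e) - f (endB e) ∣

InImage : ∀ {s} → BipGraph s → (V s → ℕ) → ℕ → Set
InImage G f i = ∃[ e ] (e ∈ edges G × edgeLabel f e ≡ i)

record IsRhoBarLabeling {s : ℕ} (G : BipGraph s) (t : ℕ) (f : V s → ℕ) : Set where
  field
    inRange   : (v : V s) → f v ≤ t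
    injective : (u v : V s) → f u ≡ f v → u ≡ v
    bound     : 2 * nEdges G ≤ t
    edgeInj   : (e e′ : Edge s) → e ∈ edges G → e′ ∈ edges G →
                edgeLabel f e ≡ edgeLabel f e′ → e ≡ e′
    noComplement : ¬ (∃[ i ] (1 ≤ i × i ≤ nEdges G × InImage G f i × InImage G f (suc t ∸ i)))

record IsUniformAB {s : ℕ} (G : BipGraph s) (t : ℕ) (f : V s → ℕ) : Set where
  field
    rhoBar : IsRhoBarLabeling G t f
    lam    : ℕ
    sideA  : (a : Fin s) → f (inj₁ a) ≤ lam
    sideB  : (b : Fin s) → lam < f (inj₂ b)

record IsUniformBA {s : ℕ} (G : BipGraph s) (t : ℕ) (f : V s → ℕ) : Set where
  field
    rhoBar : IsRhoBarLabeling G t f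
    lam    : ℕ
    sideB  : (b : Fin s) → f (inj₂ b) ≤ lam
    sideA  : (a : Fin s) → lam < f (inj₁ a)

shift : ∀ {s} → ℕ → (V s → ℕ) → ℕ → V s → ℕ
shift t f k v = (f v + k) % suc t

σ₁ : ℕ → (ℕ → ℤ) → ℤ
σ₁ zero g = + 0
σ₁ (suc n) g = σ₁ n g ℤ.+ g (suc n)

σ₀ : ℕ → (ℕ → ℤ) → ℤ
σ₀ zero g = + 0
σ₀ (suc n) g = σ₀ n g ℤ.+ g n

xs : (ℕ → ℕ) → ℕ → ℤ
xs a i = σ₁ i (λ j → + a (2 * j)) ℤ.- σ₀ i (λ j → + a (2 * j + 1))

ys : ℕ → (ℕ → ℕ) → ℕ → ℤ
ys r a 1 = + r ℤ.- + a 1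
ys r a i = (+ r ℤ.+ σ₁ (i ∸ 1) (λ j → + a (2 * j))) ℤ.- σ₀ i (λ j → + a (2 * j + 1))

{-# OPTIONS --safe #-}
-- The increasing a_i give 0 = x₀ ≤ x₁ ≤ … ≤ x_{s-1} < y_s ≤ … ≤ y₁ = r − a₁, so every A-label lies
-- below every B-label. A k-shift that wraps no label is a translation and keeps every edge label;
-- one that wraps exactly the B-labels turns every edge label l into r − l, which permutes the
-- forbidden pairs {i, r − i}. Either way it is again a ρ̄-labeling, ordered (A,B) resp. (B,A).
-- Conversely, the vertex labelled 0 goes to k, whereas a wrapped label x + k − r lies below k:
-- so an (A,B)-ordering forbids y₁ to wrap, and a (B,A)-ordering forces y_s to wrap and, since
-- x_{s-1} < y_s, forbids x_{s-1} to wrap.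
module Submission where

open import Defs
open import Data.Nat using (ℕ; _+_; _*_; _∸_; _≤_; _<_)
open import Data.Integer as ℤ using (ℤ; +_)
open import Data.Fin using (Fin)
open import Data.Sum using (_⊎_; inj₁; inj₂)
open import Data.Product using (_×_; _,_; ∃; ∃-syntax)
open import Function.Bundles using (_⇔_)
open import Relation.Binary.PropositionalEquality using (_≡_)

open import Data.Nat using (zero; suc; z≤n; s≤s; _%_; ∣_-_∣)
open import Data.Nat.DivMod using (m<n⇒m%n≡m; m≤n⇒[n∸m]%m≡n%m)
open import Data.Nat.Properties
import Data.Integer.Properties as ℤP
open import Algebra.Properties.CommutativeSemigroup +-commutativeSemigroup using (xy∙z≈xz∙y)
import Data.Integer.Tactic.RingSolver as ℤ-Solver
open import Data.Product using (proj₁; proj₂)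
open import Data.Product.Function.NonDependent.Propositional using (_×-⇔_)
open import Function.Base using (flip)
open import Function.Bundles using (mk⇔)
open import Function.Properties.Equivalence using () renaming (trans to ⇔-trans)
open import Relation.Binary.Core using (Rel)
open import Relation.Binary.Definitions using (Reflexive; Transitive)
open import Relation.Binary.PropositionalEquality
  using (refl; sym; trans; cong; cong₂; subst; subst₂; module ≡-Reasoning)
open import Relation.Nullary using (contradiction)

%-wrap : ∀ {t m} → suc t ≤ m → m ∸ suc t ≤ t → m % suc t ≡ m ∸ suc t
%-wrap t<m m∸t≤t = trans (sym (m≤n⇒[n∸m]%m≡n%m t<m)) (m<n⇒m%n≡m (s≤s m∸t≤t))

wrapped<k : ∀ {t x k} → x ≤ t → suc t ≤ x + k → x + k ∸ suc t < k
wrapped<k {t} {x} {k} x≤t t<x+k =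
  subst (x + k ∸ suc t <_) (m+n∸m≡n (suc t) k) (∸-monoˡ-< (+-monoˡ-< k (s≤s x≤t)) t<x+k)

module _ {s} (t : ℕ) (f : V s → ℕ) (k : ℕ) where

  shift-noWrap : ∀ v → f v + k ≤ t → shift t f k v ≡ f v + k
  shift-noWrap v fv+k≤t = m<n⇒m%n≡m (s≤s fv+k≤t)

  shift-wrap : ∀ v → f v ≤ t → k ≤ t → t < f v + k → shift t f k v ≡ f v + k ∸ suc t
  shift-wrap v fv≤t k≤t t<fv+k = %-wrap t<fv+k (≤-trans (<⇒≤ (wrapped<k fv≤t t<fv+k)) k≤t)

module _ {s} {G : BipGraph s} {t : ℕ} {f g : V s → ℕ} (ρ : IsRhoBarLabeling G t f)
         (g-inRange : ∀ v → g v ≤ t) (g-injective : ∀ u v → g u ≡ g v → u ≡ v) where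
  open IsRhoBarLabeling ρ

  isRhoBar-sameEdgeLabels : (∀ e → edgeLabel g e ≡ edgeLabel f e) → IsRhoBarLabeling G t g
  isRhoBar-sameEdgeLabels same = record
    { inRange      = g-inRange
    ; injective    = g-injective
    ; bound        = bound
    ; edgeInj      = λ e e′ e∈ e′∈ eq → edgeInj e e′ e∈ e′∈ (trans (sym (same e)) (trans eq (same e′)))
    ; noComplement = λ (i , 1≤i , i≤m , i∈ , j∈) → noComplement (i , 1≤i , i≤m , image i∈ , image j∈)
    }
    where
    image : ∀ {l} → InImage G g l → InImage G f l
    image (e , e∈ , refl) = e , e∈ , sym (same e)

  isRhoBar-complementedEdgeLabels :
    (∀ e → edgeLabel g e ≡ suc t ∸ edgeLabel f e) → IsRhoBarLabeling G t g
  isRhoBar-complementedEdgeLabels compl = record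
    { inRange      = g-inRange
    ; injective    = g-injective
    ; bound        = bound
    ; edgeInj      = λ e e′ e∈ e′∈ eq → edgeInj e e′ e∈ e′∈
        (∸-cancelˡ-≡ (label≤ e) (label≤ e′) (trans (sym (compl e)) (trans eq (compl e′))))
    ; noComplement = λ (i , 1≤i , i≤m , i∈ , j∈) → noComplement
        (i , 1≤i , i≤m , subst (InImage G f) (m∸[m∸n]≡n (i≤1+t i≤m)) (image j∈) , image i∈)
    }
    where
    label≤ : ∀ e → edgeLabel f e ≤ suc t
    label≤ e = m≤n⇒m≤1+n (≤-trans (∣m-n∣≤m⊔n (f (endA e)) (f (endB e))) (⊔-lub (inRange (endA e)) (inRange (endB e))))

    i≤1+t : ∀ {i} → i ≤ nEdges G → i ≤ suc t
    i≤1+t i≤m = m≤n⇒m≤1+n (≤-trans i≤m (≤-trans (m≤n*m (nEdges G) 2) bound))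

    image : ∀ {l} → InImage G g l → InImage G f (suc t ∸ l)
    image (e , e∈ , refl) = e , e∈ , trans (sym (m∸[m∸n]≡n (label≤ e))) (cong (suc t ∸_) (sym (compl e)))

wrapped-distance : ∀ {t x y k} → x ≤ y → suc t ≤ y + k → y + k ∸ suc t ≤ x + k →
                   ∣ x + k - (y + k ∸ suc t) ∣ ≡ suc t ∸ ∣ x - y ∣
wrapped-distance {t} {x} {y} {k} x≤y t<y+k w≤x+k = begin
  ∣ x + k - w ∣         ≡⟨ m≤n⇒∣n-m∣≡n∸m w≤x+k ⟩
  x + k ∸ w             ≡⟨ sym (m+n∸n≡m (x + k ∸ w) d) ⟩
  (x + k ∸ w) + d ∸ d   ≡⟨ cong (_∸ d) sum≡1+t ⟩
  suc t ∸ d             ≡⟨ cong (suc t ∸_) (sym (m≤n⇒∣m-n∣≡n∸m x≤y)) ⟩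
  suc t ∸ ∣ x - y ∣     ∎
  where
  open ≡-Reasoning
  w = y + k ∸ suc t
  d = y ∸ x
  sum≡1+t : (x + k ∸ w) + d ≡ suc t
  sum≡1+t = begin
    (x + k ∸ w) + d  ≡⟨ sym (+-∸-comm d w≤x+k) ⟩
    x + k + d ∸ w    ≡⟨ cong (_∸ w) (xy∙z≈xz∙y x k d) ⟩
    x + d + k ∸ w    ≡⟨ cong (λ z → z + k ∸ w) (m+[n∸m]≡n x≤y) ⟩
    y + k ∸ w        ≡⟨ m∸[m∸n]≡n t<y+k ⟩
    suc t            ∎

module _ {s} {G : BipGraph s} {t : ℕ} {f : V s → ℕ} {k : ℕ} (ρ : IsRhoBarLabeling G t f) where
  open IsRhoBarLabeling ρ

  shift-isRhoBar-noWrap : (∀ v → f v + k ≤ t) → IsRhoBarLabeling G t (shift t f k)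
  shift-isRhoBar-noWrap noWrap = isRhoBar-sameEdgeLabels ρ inRange′ injective′ sameLabels
    where
    shift≡ : ∀ v → shift t f k v ≡ f v + k
    shift≡ v = shift-noWrap t f k v (noWrap v)

    inRange′ : ∀ v → shift t f k v ≤ t
    inRange′ v = subst (_≤ t) (sym (shift≡ v)) (noWrap v)

    injective′ : ∀ u v → shift t f k u ≡ shift t f k v → u ≡ v
    injective′ u v eq = injective u v (+-cancelʳ-≡ k _ _ (trans (sym (shift≡ u)) (trans eq (shift≡ v))))

    sameLabels : ∀ e → edgeLabel (shift t f k) e ≡ edgeLabel f e
    sameLabels (a , b) = begin
      ∣ shift t f k (inj₁ a) - shift t f k (inj₂ b) ∣ ≡⟨ cong₂ ∣_-_∣ (shift≡ (inj₁ a)) (shift≡ (inj₂ b)) ⟩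
      ∣ f (inj₁ a) + k - f (inj₂ b) + k ∣             ≡⟨ cong₂ ∣_-_∣ (+-comm (f (inj₁ a)) k) (+-comm (f (inj₂ b)) k) ⟩
      ∣ k + f (inj₁ a) - k + f (inj₂ b) ∣             ≡⟨ ∣m+n-m+o∣≡∣n-o∣ k _ _ ⟩
      ∣ f (inj₁ a) - f (inj₂ b) ∣                     ∎
      where open ≡-Reasoning

  shift-isRhoBar-wrapB : k ≤ t → (∀ a b → f (inj₁ a) < f (inj₂ b)) →
    (∀ a → f (inj₁ a) + k ≤ t) → (∀ b → t < f (inj₂ b) + k) → IsRhoBarLabeling G t (shift t f k)
  shift-isRhoBar-wrapB k≤t A<B noWrapA wrapB =
    isRhoBar-complementedEdgeLabels ρ inRange′ injective′ complLabels
    where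
    shiftA≡ : ∀ a → shift t f k (inj₁ a) ≡ f (inj₁ a) + k
    shiftA≡ a = shift-noWrap t f k (inj₁ a) (noWrapA a)

    shiftB≡ : ∀ b → shift t f k (inj₂ b) ≡ f (inj₂ b) + k ∸ suc t
    shiftB≡ b = shift-wrap t f k (inj₂ b) (inRange (inj₂ b)) k≤t (wrapB b)

    shiftB<k : ∀ b → f (inj₂ b) + k ∸ suc t < k
    shiftB<k b = wrapped<k (inRange (inj₂ b)) (wrapB b)

    inRange′ : ∀ v → shift t f k v ≤ t
    inRange′ (inj₁ a) = subst (_≤ t) (sym (shiftA≡ a)) (noWrapA a)
    inRange′ (inj₂ b) = subst (_≤ t) (sym (shiftB≡ b)) (≤-trans (<⇒≤ (shiftB<k b)) k≤t)

    shiftB<shiftA : ∀ a b → shift t f k (inj₂ b) < shift t f k (inj₁ a)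
    shiftB<shiftA a b = subst₂ _<_ (sym (shiftB≡ b)) (sym (shiftA≡ a))
      (<-≤-trans (shiftB<k b) (m≤n+m k (f (inj₁ a))))

    injective′ : ∀ u v → shift t f k u ≡ shift t f k v → u ≡ v
    injective′ (inj₁ a) (inj₁ a′) eq = injective _ _
      (+-cancelʳ-≡ k _ _ (trans (sym (shiftA≡ a)) (trans eq (shiftA≡ a′))))
    injective′ (inj₂ b) (inj₂ b′) eq = injective _ _ (+-cancelʳ-≡ k _ _
      (∸-cancelʳ-≡ (wrapB b) (wrapB b′) (trans (sym (shiftB≡ b)) (trans eq (shiftB≡ b′)))))
    injective′ (inj₁ a) (inj₂ b) eq = contradiction (sym eq) (<⇒≢ (shiftB<shiftA a b))
    injective′ (inj₂ b) (inj₁ a) eq = contradiction eq (<⇒≢ (shiftB<shiftA a b))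

    complLabels : ∀ e → edgeLabel (shift t f k) e ≡ suc t ∸ edgeLabel f e
    complLabels (a , b) = trans (cong₂ ∣_-_∣ (shiftA≡ a) (shiftB≡ b))
      (wrapped-distance (<⇒≤ (A<B a b)) (wrapB b) (≤-trans (<⇒≤ (shiftB<k b)) (m≤n+m k (f (inj₁ a)))))

record Separated {s : ℕ} (f : V s → ℕ) : Set where
  field
    zeroA     : Fin s
    f-zeroA   : f (inj₁ zeroA) ≡ 0
    maxA      : Fin s
    ≤-maxA    : ∀ a → f (inj₁ a) ≤ f (inj₁ maxA)
    minB      : Fin s
    minB-≤    : ∀ b → f (inj₂ minB) ≤ f (inj₂ b)
    maxB      : Fin s
    ≤-maxB    : ∀ b → f (inj₂ b) ≤ f (inj₂ maxB)
    maxA<minB : f (inj₁ maxA) < f (inj₂ minB)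

module _ {s} {G : BipGraph s} {t : ℕ} {f : V s → ℕ}
         (ρ : IsRhoBarLabeling G t f) (sep : Separated f) {k : ℕ} (k≤t : k ≤ t) where
  open IsRhoBarLabeling ρ
  open Separated sep

  private
    A<B : ∀ a b → f (inj₁ a) < f (inj₂ b)
    A<B a b = ≤-<-trans (≤-maxA a) (<-≤-trans maxA<minB (minB-≤ b))

    shift-zeroA : shift t f k (inj₁ zeroA) ≡ k
    shift-zeroA = trans (cong (λ z → (z + k) % suc t) f-zeroA) (m<n⇒m%n≡m (s≤s k≤t))

  shift-isUniformAB⇔ : IsUniformAB G t (shift t f k) ⇔ f (inj₂ maxB) + k ≤ t
  shift-isUniformAB⇔ = mk⇔ to from
    where
    to : IsUniformAB G t (shift t f k) → f (inj₂ maxB) + k ≤ t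
    to U = ≮⇒≥ λ t<maxB+k → <-irrefl refl (begin-strict
      k                                     ≡⟨ shift-zeroA ⟨
      shift t f k (inj₁ zeroA)              ≤⟨ sideA zeroA ⟩
      lam                                   <⟨ sideB maxB ⟩
      shift t f k (inj₂ maxB)               ≡⟨ shift-wrap t f k (inj₂ maxB) (inRange _) k≤t t<maxB+k ⟩
      f (inj₂ maxB) + k ∸ suc t             <⟨ wrapped<k (inRange _) t<maxB+k ⟩
      k                                     ∎)
      where open IsUniformAB U
            open ≤-Reasoning

    from : f (inj₂ maxB) + k ≤ t → IsUniformAB G t (shift t f k)
    from maxB+k≤t = record
      { rhoBar = shift-isRhoBar-noWrap ρ noWrap
      ; lam    = f (inj₁ maxA) + k
      ; sideA  = λ a → subst (_≤ f (inj₁ maxA) + k) (sym (shift-noWrap t f k _ (noWrap (inj₁ a))))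
                         (+-monoˡ-≤ k (≤-maxA a))
      ; sideB  = λ b → subst (f (inj₁ maxA) + k <_) (sym (shift-noWrap t f k _ (noWrap (inj₂ b))))
                         (+-monoˡ-< k (A<B maxA b))
      }
      where
      noWrap : ∀ v → f v + k ≤ t
      noWrap (inj₁ a) = ≤-trans (+-monoˡ-≤ k (<⇒≤ (A<B a maxB))) maxB+k≤t
      noWrap (inj₂ b) = ≤-trans (+-monoˡ-≤ k (≤-maxB b)) maxB+k≤t

  shift-isUniformBA⇔ : IsUniformBA G t (shift t f k) ⇔ (t < f (inj₂ minB) + k × f (inj₁ maxA) + k ≤ t)
  shift-isUniformBA⇔ = mk⇔ to from
    where
    to : IsUniformBA G t (shift t f k) → t < f (inj₂ minB) + k × f (inj₁ maxA) + k ≤ t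
    to U = minB-wraps , maxA-stays
      where
      open IsUniformBA U
      open ≤-Reasoning
      minB-wraps : t < f (inj₂ minB) + k
      minB-wraps = ≰⇒> λ minB+k≤t → <-irrefl refl (begin-strict
        k                              ≤⟨ m≤n+m k _ ⟩
        f (inj₂ minB) + k              ≡⟨ shift-noWrap t f k (inj₂ minB) minB+k≤t ⟨
        shift t f k (inj₂ minB)        ≤⟨ sideB minB ⟩
        lam                            <⟨ sideA zeroA ⟩
        shift t f k (inj₁ zeroA)       ≡⟨ shift-zeroA ⟩
        k                              ∎)
      maxA-stays : f (inj₁ maxA) + k ≤ t
      maxA-stays = ≮⇒≥ λ t<maxA+k → <-irrefl refl (begin-strict
        f (inj₁ maxA) + k ∸ suc t      ≤⟨ ∸-monoˡ-≤ (suc t) (+-monoˡ-≤ k (<⇒≤ maxA<minB)) ⟩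
        f (inj₂ minB) + k ∸ suc t      ≡⟨ shift-wrap t f k (inj₂ minB) (inRange _) k≤t
                                            (<-≤-trans t<maxA+k (+-monoˡ-≤ k (<⇒≤ maxA<minB))) ⟨
        shift t f k (inj₂ minB)        ≤⟨ sideB minB ⟩
        lam                            <⟨ sideA maxA ⟩
        shift t f k (inj₁ maxA)        ≡⟨ shift-wrap t f k (inj₁ maxA) (inRange _) k≤t t<maxA+k ⟩
        f (inj₁ maxA) + k ∸ suc t      ∎)

    from : t < f (inj₂ minB) + k × f (inj₁ maxA) + k ≤ t → IsUniformBA G t (shift t f k)
    from (minB-wraps , maxA+k≤t) = record
      { rhoBar = shift-isRhoBar-wrapB ρ k≤t A<B noWrapA wrapB
      ; lam    = f (inj₂ maxB) + k ∸ suc t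
      ; sideB  = λ b → subst (_≤ f (inj₂ maxB) + k ∸ suc t) (sym (shiftB≡ b))
                         (∸-monoˡ-≤ (suc t) (+-monoˡ-≤ k (≤-maxB b)))
      ; sideA  = λ a → subst (f (inj₂ maxB) + k ∸ suc t <_) (sym (shift-noWrap t f k _ (noWrapA a)))
                         (<-≤-trans (wrapped<k (inRange _) (wrapB maxB)) (m≤n+m k _))
      }
      where
      noWrapA : ∀ a → f (inj₁ a) + k ≤ t
      noWrapA a = ≤-trans (+-monoˡ-≤ k (≤-maxA a)) maxA+k≤t
      wrapB : ∀ b → t < f (inj₂ b) + k
      wrapB b = <-≤-trans minB-wraps (+-monoˡ-≤ k (minB-≤ b))
      shiftB≡ : ∀ b → shift t f k (inj₂ b) ≡ f (inj₂ b) + k ∸ suc t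
      shiftB≡ b = shift-wrap t f k (inj₂ b) (inRange _) k≤t (wrapB b)

module _ {a ℓ} {A : Set a} {_≼_ : Rel A ℓ} (≼-refl : Reflexive _≼_) (≼-trans : Transitive _≼_)
         (P : ℕ → A) {n : ℕ} (step : ∀ i → suc i ≤ n → P i ≼ P (suc i)) where

  stepwise-mono : ∀ {i j} → i ≤ j → j ≤ n → P i ≼ P j
  stepwise-mono i≤j j≤n with m≤n⇒m<n∨m≡n i≤j
  ... | inj₂ refl        = ≼-refl
  ... | inj₁ (s≤s i≤j′) = ≼-trans (stepwise-mono i≤j′ (≤-trans (n≤1+n _) j≤n)) (step _ j≤n)

+m-+n≡+[m∸n] : ∀ {m n} → n ≤ m → + m ℤ.- + n ≡ + (m ∸ n)
+m-+n≡+[m∸n] {m} {n} n≤m = trans (ℤP.m-n≡m⊖n m n) (ℤP.⊖-≥ n≤m)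

i≤i+[m-n] : ∀ i {m n} → n ≤ m → i ℤ.≤ i ℤ.+ (+ m ℤ.- + n)
i≤i+[m-n] i n≤m = subst (λ d → i ℤ.≤ i ℤ.+ d) (sym (+m-+n≡+[m∸n] n≤m)) (ℤP.i≤i+j i _)

i<i+[m-n] : ∀ i {m n} → n < m → i ℤ.< i ℤ.+ (+ m ℤ.- + n)
i<i+[m-n] i n<m = subst₂ ℤ._<_ (ℤP.+-identityʳ i) (cong (λ d → i ℤ.+ d) (sym (+m-+n≡+[m∸n] (<⇒≤ n<m))))
  (ℤP.+-monoʳ-< i (ℤ.+<+ (m<n⇒0<n∸m n<m)))

xs-suc : ∀ a i → xs a (suc i) ≡ xs a i ℤ.+ (+ a (2 * suc i) ℤ.- + a (2 * i + 1))
xs-suc a i = regroup (σ₁ i λ j → + a (2 * j)) (σ₀ i λ j → + a (2 * j + 1)) _ _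
  where
  regroup : ∀ S T p q → (S ℤ.+ p) ℤ.- (T ℤ.+ q) ≡ (S ℤ.- T) ℤ.+ (p ℤ.- q)
  regroup = ℤ-Solver.solve-∀

ys-suc : ∀ r a i → ys r a (suc i) ≡ xs a i ℤ.+ (+ r ℤ.- + a (2 * i + 1))
ys-suc r a zero    = sym (ℤP.+-identityˡ _)
ys-suc r a (suc i) = regroup (σ₁ (suc i) λ j → + a (2 * j)) (σ₀ (suc i) λ j → + a (2 * j + 1)) (+ r) _
  where
  regroup : ∀ S T r q → (r ℤ.+ S) ℤ.- (T ℤ.+ q) ≡ (S ℤ.- T) ℤ.+ (r ℤ.- q)
  regroup = ℤ-Solver.solve-∀

xs[i]≤xs[1+i] : ∀ a i → a (2 * i + 1) ≤ a (2 * suc i) → xs a i ℤ.≤ xs a (suc i)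
xs[i]≤xs[1+i] a i le = subst (xs a i ℤ.≤_) (sym (xs-suc a i)) (i≤i+[m-n] _ le)

ys[2+i]≤ys[1+i] : ∀ r a i → a (2 * suc i) ≤ a (2 * suc i + 1) → ys r a (suc (suc i)) ℤ.≤ ys r a (suc i)
ys[2+i]≤ys[1+i] r a i le = subst (ys r a (suc (suc i)) ℤ.≤_) (sym ys≡) (i≤i+[m-n] _ le)
  where
  open ≡-Reasoning
  p = + a (2 * suc i)
  q = + a (2 * i + 1)
  c = + a (2 * suc i + 1)
  regroup : ∀ X r p q c → X ℤ.+ (r ℤ.- q) ≡ X ℤ.+ (p ℤ.- q) ℤ.+ (r ℤ.- c) ℤ.+ (c ℤ.- p)
  regroup = ℤ-Solver.solve-∀
  ys≡ : ys r a (suc i) ≡ ys r a (suc (suc i)) ℤ.+ (c ℤ.- p)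
  ys≡ = begin
    ys r a (suc i)                                 ≡⟨ ys-suc r a i ⟩
    xs a i ℤ.+ (+ r ℤ.- q)                         ≡⟨ regroup (xs a i) (+ r) p q c ⟩
    xs a i ℤ.+ (p ℤ.- q) ℤ.+ (+ r ℤ.- c) ℤ.+ (c ℤ.- p) ≡⟨ cong (λ X → X ℤ.+ (+ r ℤ.- c) ℤ.+ (c ℤ.- p)) (sym (xs-suc a i)) ⟩
    xs a (suc i) ℤ.+ (+ r ℤ.- c) ℤ.+ (c ℤ.- p)     ≡⟨ cong (ℤ._+ (c ℤ.- p)) (sym (ys-suc r a (suc i))) ⟩
    ys r a (suc (suc i)) ℤ.+ (c ℤ.- p)             ∎

module _ {a : ℕ → ℕ} {n : ℕ} (a-inc : ∀ j → 1 ≤ j → j ≤ 2 * n → a j < a (j + 1)) where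

  xs-mono : ∀ {i j} → i ≤ j → j ≤ n → xs a i ℤ.≤ xs a j
  xs-mono = stepwise-mono {_≼_ = ℤ._≤_} ℤP.≤-refl ℤP.≤-trans (xs a) λ i i<n →
    xs[i]≤xs[1+i] a i (<⇒≤ (subst (λ j → a (2 * i + 1) < a j) [2i+1]+1≡2[1+i] (a-inc _ (m≤n+m 1 _) (2i+1≤2n i<n))))
    where
    [2i+1]+1≡2[1+i] : ∀ {i} → 2 * i + 1 + 1 ≡ 2 * suc i
    [2i+1]+1≡2[1+i] {i} = trans (+-assoc (2 * i) 1 1) (trans (+-comm (2 * i) 2) (sym (*-suc 2 i)))
    2i+1≤2n : ∀ {i} → suc i ≤ n → 2 * i + 1 ≤ 2 * n
    2i+1≤2n {i} i<n = ≤-trans (m≤m+n (2 * i + 1) 1) (subst (_≤ 2 * n) (sym [2i+1]+1≡2[1+i]) (*-monoʳ-≤ 2 i<n))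

  ys-antitone : ∀ r {i j} → i ≤ j → j ≤ n → ys r a (suc j) ℤ.≤ ys r a (suc i)
  ys-antitone r = stepwise-mono {_≼_ = flip ℤ._≤_} ℤP.≤-refl (flip ℤP.≤-trans) (λ i → ys r a (suc i))
    λ i i<n → ys[2+i]≤ys[1+i] r a i (<⇒≤ (a-inc _ (s≤s z≤n) (*-monoʳ-≤ 2 i<n)))

module _ {s′ t : ℕ} {a : ℕ → ℕ} {f : V (suc s′) → ℕ}
         (a-inc : ∀ j → 1 ≤ j → j ≤ 2 * s′ → a j < a (j + 1)) (a-last≤t : a (2 * s′ + 1) ≤ t) where

  private
    drop-≤ : ∀ {m n i j} → + m ≡ i → + n ≡ j → i ℤ.≤ j → m ≤ n
    drop-≤ refl refl = ℤP.drop‿+≤+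

  sequenceLabeling-separated :
    (∀ u → f (inj₁ u) ≡ 0 ⊎ ∃[ i ] (1 ≤ i × i ≤ s′ × + f (inj₁ u) ≡ xs a i)) →
    (∀ u → ∃[ i ] (1 ≤ i × i ≤ suc s′ × + f (inj₂ u) ≡ ys (suc t) a i)) →
    ∃[ u ] (f (inj₁ u) ≡ 0) → ∃[ u ] (+ f (inj₁ u) ≡ xs a s′) →
    ∃[ u ] (+ f (inj₂ u) ≡ ys (suc t) a (suc s′)) → ∃[ u ] (+ f (inj₂ u) ≡ ys (suc t) a 1) →
    Separated f
  sequenceLabeling-separated labelsA labelsB (u₀ , f-u₀) (uX , f-uX) (uY , f-uY) (u₁ , f-u₁) = record
    { zeroA = u₀ ; f-zeroA = f-u₀
    ; maxA = uX ; ≤-maxA = ≤-maxA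
    ; minB = uY ; minB-≤ = minB-≤
    ; maxB = u₁ ; ≤-maxB = ≤-maxB
    ; maxA<minB = ℤP.drop‿+<+ (subst₂ ℤ._<_ (sym f-uX) (sym f-uY)
        (subst (xs a s′ ℤ.<_) (sym (ys-suc (suc t) a s′)) (i<i+[m-n] _ (s≤s a-last≤t))))
    }
    where
    ≤-maxA : ∀ u → f (inj₁ u) ≤ f (inj₁ uX)
    ≤-maxA u with labelsA u
    ... | inj₁ f≡0                  = subst (_≤ f (inj₁ uX)) (sym f≡0) z≤n
    ... | inj₂ (i , _ , i≤s′ , f≡x) = drop-≤ f≡x f-uX (xs-mono a-inc i≤s′ ≤-refl)

    minB-≤ : ∀ u → f (inj₂ uY) ≤ f (inj₂ u)
    minB-≤ u with labelsB u
    ... | suc i , _ , s≤s i≤s′ , f≡y = drop-≤ f-uY f≡y (ys-antitone a-inc (suc t) i≤s′ ≤-refl)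

    ≤-maxB : ∀ u → f (inj₂ u) ≤ f (inj₂ u₁)
    ≤-maxB u with labelsB u
    ... | suc i , _ , s≤s i≤s′ , f≡y = drop-≤ f≡y f-u₁ (ys-antitone a-inc (suc t) z≤n i≤s′)

+≤⇔≤∸ : ∀ {m n o} → m ≤ o → (m + n ≤ o ⇔ n ≤ o ∸ m)
+≤⇔≤∸ {m} {n} {o} m≤o = mk⇔ (λ m+n≤o → m+n≤o⇒m≤o∸n n (subst (_≤ o) (+-comm m n) m+n≤o))
                            (λ n≤o∸m → subst (_≤ o) (+-comm n m) (m≤o∸n⇒m+n≤o n m≤o n≤o∸m))

≤⇔+≤+ : ∀ {m n} → m ≤ n ⇔ + m ℤ.≤ + n
≤⇔+≤+ = mk⇔ ℤ.+≤+ ℤP.drop‿+≤+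

noWrap⇔ : ∀ {t x k X} → x ≤ t → + x ≡ X → (x + k ≤ t ⇔ + k ℤ.≤ + t ℤ.- X)
noWrap⇔ {t} {x} {k} x≤t refl = ⇔-trans (+≤⇔≤∸ x≤t)
  (subst (λ d → k ≤ t ∸ x ⇔ + k ℤ.≤ d) (sym (+m-+n≡+[m∸n] x≤t)) ≤⇔+≤+)

wrap⇔ : ∀ {t y k Y} → y ≤ suc t → + y ≡ Y → (t < y + k ⇔ + suc t ℤ.- Y ℤ.≤ + k)
wrap⇔ {t} {y} {k} y≤1+t refl = ⇔-trans
  (mk⇔ (m≤n+o⇒m∸n≤o (suc t) y) (λ 1+t∸y≤k → ≤-trans (m≤n+m∸n (suc t) y) (+-monoʳ-≤ y 1+t∸y≤k)))
  (subst (λ d → suc t ∸ y ≤ k ⇔ d ℤ.≤ + k) (sym (+m-+n≡+[m∸n] y≤1+t)) ≤⇔+≤+)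

noWrap⇔≤pred : ∀ {t y n k} → 1 ≤ n → n ≤ t → + y ≡ + suc t ℤ.- + n → (y + k ≤ t ⇔ k ≤ n ∸ 1)
noWrap⇔≤pred {t} {y} {suc n} {k} _ n<t y≡ =
  subst (λ m → y + k ≤ t ⇔ k ≤ m) t∸y≡n (+≤⇔≤∸ (subst (_≤ t) (sym y≡t∸n) (m∸n≤m t n)))
  where
  y≡t∸n : y ≡ t ∸ n
  y≡t∸n = ℤP.+-injective (trans y≡ (+m-+n≡+[m∸n] (s≤s (<⇒≤ n<t))))
  t∸y≡n : t ∸ y ≡ n
  t∸y≡n = trans (cong (t ∸_) y≡t∸n) (m∸[m∸n]≡n (<⇒≤ n<t))

attains-xs-last : ∀ {s′} {a : ℕ → ℕ} (g : Fin (suc s′) → ℕ) → ∃[ u ] (g u ≡ 0) →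
  (∀ i → 1 ≤ i → i ≤ s′ → ∃[ u ] (+ g u ≡ xs a i)) → ∃[ u ] (+ g u ≡ xs a s′)
attains-xs-last {zero}   g (u , gu≡0) _ = u , cong +_ gu≡0
attains-xs-last {suc s′} g _ attains     = attains (suc s′) (s≤s z≤n) ≤-refl

corollary5 : (r s : ℕ) → 1 ≤ s → 2 * s ≤ r →
    (a : ℕ → ℕ) →
    ((i : ℕ) → 1 ≤ i → i ≤ 2 * s ∸ 1 → 1 ≤ a i × a i ≤ r ∸ 1) →
    ((i : ℕ) → 1 ≤ i → i ≤ 2 * s ∸ 2 → a i < a (i + 1)) →
    (G : BipGraph s) → (f : V s → ℕ) →
    IsRhoBarLabeling G (r ∸ 1) f →
    ((u : Fin s) → (f (inj₁ u) ≡ 0 ⊎ ∃[ i ] (1 ≤ i × i ≤ s ∸ 1 × + f (inj₁ u) ≡ xs a i))) →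
    (∃[ u ] (f (inj₁ u) ≡ 0)) →
    ((i : ℕ) → 1 ≤ i → i ≤ s ∸ 1 → ∃[ u ] (+ f (inj₁ u) ≡ xs a i)) →
    ((u : Fin s) → ∃[ i ] (1 ≤ i × i ≤ s × + f (inj₂ u) ≡ ys r a i)) →
    ((i : ℕ) → 1 ≤ i → i ≤ s → ∃[ u ] (+ f (inj₂ u) ≡ ys r a i)) →
    ((k : ℕ) → k ≤ r ∸ 1 →
      (IsUniformAB G (r ∸ 1) (shift (r ∸ 1) f k) ⇔ k ≤ a 1 ∸ 1))
    ×
    ((k : ℕ) → k ≤ r ∸ 1 →
      (IsUniformBA G (r ∸ 1) (shift (r ∸ 1) f k) ⇔
        ((+ r ℤ.- ys r a s) ℤ.≤ + k × + k ℤ.≤ (+ r ℤ.- + 1) ℤ.- xs a (s ∸ 1))))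
corollary5 zero    zero     ()
corollary5 zero    (suc s′) _ ()
corollary5 (suc t) zero     ()
corollary5 (suc t) (suc s′) _ _ a a-range a-inc G f ρ labelsA zeroA attainsA labelsB attainsB =
  (λ k k≤t → ⇔-trans (shift-isUniformAB⇔ ρ sep k≤t) (noWrap⇔≤pred 1≤a₁ a₁≤t (proj₂ maxB))) ,
  (λ k k≤t → ⇔-trans (shift-isUniformBA⇔ ρ sep k≤t)
    (wrap⇔ (m≤n⇒m≤1+n (inRange _)) (proj₂ minB) ×-⇔ noWrap⇔ (inRange _) (proj₂ maxA)))
  where
  open IsRhoBarLabeling ρ
  a-inc′ : ∀ j → 1 ≤ j → j ≤ 2 * s′ → a j < a (j + 1)
  a-inc′ j 1≤j j≤2s′ = a-inc j 1≤j (subst (λ m → j ≤ m ∸ 2) (sym (*-suc 2 s′)) j≤2s′)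
  a-range′ : ∀ j → 1 ≤ j → j ≤ suc (2 * s′) → 1 ≤ a j × a j ≤ t
  a-range′ j 1≤j j≤1+2s′ = a-range j 1≤j (subst (λ m → j ≤ m ∸ 1) (sym (*-suc 2 s′)) j≤1+2s′)
  1≤a₁ = proj₁ (a-range′ 1 ≤-refl (s≤s z≤n))
  a₁≤t = proj₂ (a-range′ 1 ≤-refl (s≤s z≤n))
  maxA = attains-xs-last {a = a} (λ u → f (inj₁ u)) zeroA attainsA
  minB = attainsB (suc s′) (s≤s z≤n) ≤-refl
  maxB = attainsB 1 ≤-refl (s≤s z≤n)
  sep = sequenceLabeling-separated a-inc′ (proj₂ (a-range′ (2 * s′ + 1) (m≤n+m 1 _) (≤-reflexive (+-comm (2 * s′) 1))))
          labelsA labelsB zeroA maxA minB maxB
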